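{- Let $W_n$ be the group of signed permutations of $\{\pm1,\dots,\pm n\}$ and let $H \le W_n$ be a subgroup such that (1) the natural projection $H \to S_n$ is surjective, and (2) $H$ contains an element which, as a permutation of the $2n$ letters $\{\pm1,\dots,\pm n\}$, is a product of a $2$-cycle and a disjoint $4$-cycle (and fixes all other letters). Then $H$ contains $W_n^+$.
   Context: $W_n$ is the group of permutations $\pi$ of $\{\pm1,\dots,\pm n\}$ satisfying $\pi(-k) = -\pi(k)$ for all $k$; it is isomorphic to $(\mathbb{Z}/2\mathbb{Z})^n \rtimes S_n$, and the natural projection $W_n \to S_n$ sends $\pi$ to the permutation $k \mapsto |\pi(k)|$ of $\{1,\dots,n\}$. $W_n^+$ is the subgroup of those $\pi \in W_n$ for which the number of $k \in \{1,\dots,n\}$ with $\pi(k) < 0$ is even (this is $\ker(\Sigma')\rtimes S_n$, where $\Sigma' : (\mathbb{Z}/2)^n \to \mathbb{Z}/2$ is the summation map). -}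

module Defs where

open import Data.Nat using (ℕ; zero; suc; _+_)
open import Data.Nat.Divisibility using (_∣_)
open import Data.Bool using (Bool; true; false; _xor_; if_then_else_)
open import Data.Fin using (Fin)
open import Data.Vec using (Vec; []; _∷_; lookup; tabulate; map)
open import Data.Product using (_×_; _,_; proj₁; proj₂; Σ; ∃; ∃-syntax)
open import Relation.Binary.PropositionalEquality using (_≡_; _≢_)
open import Function.Definitions using (Injective)

-- Letters ±1,…,±n are encoded as pairs (s , k) : Bool × Fin n,
-- where s = true means the negative letter -(k+1), s = false the positive one.
Letter : ℕ → Set
Letter n = Bool × Fin n

-- A (raw) signed permutation is recorded by the images of the positive letters:
-- entry k is π(+k) = (sign , index).  π(-k) = -π(k) is then forced.
Raw : ℕ → Set
Raw n = Vec (Letter n) n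

underlying : ∀ {n} → Raw n → Fin n → Fin n
underlying v k = proj₂ (lookup v k)

IsSignedPerm : ∀ {n} → Raw n → Set
IsSignedPerm v = Injective _≡_ _≡_ (underlying v)

act : ∀ {n} → Raw n → Letter n → Letter n
act v (s , k) = (s xor proj₁ (lookup v k) , proj₂ (lookup v k))

_∘ˢ_ : ∀ {n} → Raw n → Raw n → Raw n
π ∘ˢ ρ = tabulate (λ k → act π (lookup ρ k))

idˢ : ∀ {n} → Raw n
idˢ = tabulate (λ k → (false , k))

IsPerm : ∀ {n} → Vec (Fin n) n → Set
IsPerm σ = Injective _≡_ _≡_ (lookup σ)

proj : ∀ {n} → Raw n → Vec (Fin n) n
proj v = map proj₂ v

record IsSubgroup {n} (H : Raw n → Set) : Set where
  field
    sub     : ∀ g → H g → IsSignedPerm g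
    has-id  : H idˢ
    closed  : ∀ g h → H g → H h → H (g ∘ˢ h)
    inverse : ∀ g → H g → ∃[ h ] (H h × (h ∘ˢ g ≡ idˢ) × (g ∘ˢ h ≡ idˢ))

negCount : ∀ {m n} → Vec (Letter n) m → ℕ
negCount [] = 0
negCount ((s , _) ∷ v) = (if s then 1 else 0) + negCount v

InWPlus : ∀ {n} → Raw n → Set
InWPlus v = IsSignedPerm v × (2 ∣ negCount v)

IsTwoFourCycle : ∀ {n} → Raw n → Set
IsTwoFourCycle {n} g =
  Σ (Letter n) λ a → Σ (Letter n) λ b → Σ (Letter n) λ c →
  Σ (Letter n) λ d → Σ (Letter n) λ e → Σ (Letter n) λ f →
    (a ≢ b) × (a ≢ c) × (a ≢ d) × (a ≢ e) × (a ≢ f) ×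
    (b ≢ c) × (b ≢ d) × (b ≢ e) × (b ≢ f) ×
    (c ≢ d) × (c ≢ e) × (c ≢ f) ×
    (d ≢ e) × (d ≢ f) ×
    (e ≢ f) ×
    (act g a ≡ b) × (act g b ≡ a) ×
    (act g c ≡ d) × (act g d ≡ e) × (act g e ≡ f) × (act g f ≡ c) ×
    (∀ x → x ≢ a → x ≢ b → x ≢ c → x ≢ d → x ≢ e → x ≢ f → act g x ≡ x)

-- Every signed permutation commutes with x ↦ −x, so the 2-cycle and the 4-cycle of the given
-- element g are closed under negation: g = (a −a)(c d −c −d) with |a|, |c|, |d| distinct.
-- Hence g² is the sign change at |c| and |d|, and g composed with the sign change at |a| and |c|
-- is the involution (c −d)(d −c), which up to a sign change at |c| and |d| is the transposition
-- of these two indices. Conjugating by lifts of transpositions of S_n moves both kinds of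
-- element to every pair of indices, and they generate W_n^+: an even signed permutation fixing
-- every index above M is repaired at M by a sign change at M and 0 and a transposition, and
-- evenness rules out a lone sign change left at index 0.

module Submission where

open import Defs
open import Algebra.Bundles using (CommutativeMonoid; CommutativeRing)
import Algebra.Properties.CommutativeMonoid.Sum as Sum
open import Data.Bool using (Bool; true; false; not; _∧_; _xor_)
import Data.Bool.Properties as Bool
open import Data.Bool.Properties
  using (xor-assoc; xor-comm; xor-identityʳ; xor-same; not-distribˡ-xor; not-involutive; ¬-not;
         ∧-identityʳ; ∧-zeroʳ; xor-∧-commutativeRing)
open import Data.Empty using (⊥-elim)
open import Data.Fin using (Fin; zero; suc; toℕ; fromℕ<)
open import Data.Fin.Permutation.Components using (transpose)
open import Data.Fin.Properties using (_≟_; toℕ-injective; toℕ-fromℕ<; toℕ<n; <⇒≢; <-trans)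
open import Data.Nat using (ℕ; zero; suc; _*_; _≤_; z≤n; s≤s)
open import Data.Nat.Divisibility using (_∣_; divides)
open import Data.Nat.Properties using (m≤n⇒m<n∨m≡n; <⇒≤; <⇒≱; ≤-refl)
open import Data.Product using (_×_; _,_; proj₁; proj₂; ∃-syntax)
open import Data.Product.Properties using (≡-dec)
open import Data.Sum using (_⊎_; inj₁; inj₂; [_,_]; map)
open import Data.Vec using (Vec; []; _∷_; lookup; tabulate)
open import Data.Vec.Properties using (lookup∘tabulate; tabulate∘lookup; tabulate-cong; lookup-map)
open import Function using (_∘_)
open import Level using (0ℓ)
open import Relation.Binary.Definitions using (DecidableEquality)
open import Relation.Binary.PropositionalEquality hiding ([_])
open import Relation.Nullary using (¬_; Dec; does; yes; no)
open import Relation.Nullary.Decidable using (dec-true; dec-false; _⊎-dec_)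

-- Letters and the action of signed permutations

xor-cancelʳ : ∀ s α → (s xor α) xor α ≡ s
xor-cancelʳ s α = trans (xor-assoc s α α) (trans (cong (s xor_) (xor-same α)) (xor-identityʳ s))

xor≡false⇒≡ : ∀ {α β} → α xor β ≡ false → β ≡ α
xor≡false⇒≡ {false} eq = eq
xor≡false⇒≡ {true} {false} ()
xor≡false⇒≡ {true} {true} _ = refl

module _ {n : ℕ} where

  index : Letter n → Fin n
  index = proj₂

  neg : Letter n → Letter n
  neg (s , x) = (not s , x)

  act-neg : ∀ (g : Raw n) z → act g (neg z) ≡ neg (act g z)
  act-neg g (s , x) = cong (_, underlying g x) (sym (not-distribˡ-xor s _))

  neg-involutive : ∀ z → neg (neg z) ≡ z
  neg-involutive (s , x) = cong (_, x) (not-involutive s)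

  neg-injective : ∀ {z y} → neg z ≡ neg y → z ≡ y
  neg-injective {z} {y} eq = trans (sym (neg-involutive z)) (trans (cong neg eq) (neg-involutive y))

  neg≢ : ∀ z → neg z ≢ z
  neg≢ (false , _) ()
  neg≢ (true , _) ()

  same-index : ∀ {z x} → index z ≡ index x → z ≡ x ⊎ z ≡ neg x
  same-index {s , _} {t , _} refl with s Bool.≟ t
  ... | yes refl = inj₁ refl
  ... | no s≢t = inj₂ (cong (_, _) (¬-not s≢t))

  act-tabulate : ∀ (f : Fin n → Letter n) s x → act (tabulate f) (s , x) ≡ (s xor proj₁ (f x) , proj₂ (f x))
  act-tabulate f s x = cong (λ l → (s xor proj₁ l , proj₂ l)) (lookup∘tabulate f x)

  act-∘ˢ : ∀ (g h : Raw n) z → act (g ∘ˢ h) z ≡ act g (act h z)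
  act-∘ˢ g h (s , x) = trans (act-tabulate (λ y → act g (lookup h y)) s x) (cong (_, _) (sym (xor-assoc s _ _)))

  signChange : (Fin n → Bool) → Raw n
  signChange ε = tabulate λ x → (ε x , x)

  act-signChange : ∀ ε s x → act (signChange ε) (s , x) ≡ (s xor ε x , x)
  act-signChange ε = act-tabulate λ y → (ε y , y)

  agree-on-index : ∀ (g h : Raw n) x → act g x ≡ act h x → ∀ z → index z ≡ index x → act g z ≡ act h z
  agree-on-index g h x gx≡hx z z~x with same-index {z} {x} z~x
  ... | inj₁ refl = gx≡hx
  ... | inj₂ refl = trans (act-neg g x) (trans (cong neg gx≡hx) (sym (act-neg h x)))

  act-idˢ : ∀ z → act idˢ z ≡ z
  act-idˢ (s , x) = trans (act-signChange (λ _ → false) s x) (cong (_, x) (xor-identityʳ s))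

  ∘ˢ≡idˢ⇒act-inverse : ∀ {g h : Raw n} → g ∘ˢ h ≡ idˢ → ∀ z → act g (act h z) ≡ z
  ∘ˢ≡idˢ⇒act-inverse {g} {h} gh≡idˢ z =
    trans (sym (act-∘ˢ g h z)) (trans (cong (λ w → act w z) gh≡idˢ) (act-idˢ z))

  act-injective : ∀ {g h : Raw n} → act g ≗ act h → g ≡ h
  act-injective {g} {h} g≗h = begin
    g                              ≡⟨ tabulate∘lookup g ⟨
    tabulate (λ x → act g (false , x)) ≡⟨ tabulate-cong (λ x → g≗h (false , x)) ⟩
    tabulate (λ x → act h (false , x)) ≡⟨ tabulate∘lookup h ⟩
    h                              ∎
    where open ≡-Reasoning

-- Transpositions and sign changes

module _ {n : ℕ} where

  transpose-matchˡ : ∀ (i j : Fin n) → transpose i j i ≡ j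
  transpose-matchˡ i j rewrite dec-true (i ≟ i) refl = refl

  transpose-matchʳ : ∀ (i j : Fin n) → transpose i j j ≡ i
  transpose-matchʳ i j with j ≟ i
  ... | yes j≡i = j≡i
  ... | no _ rewrite dec-true (j ≟ j) refl = refl

  transpose-other : ∀ {i j k : Fin n} → k ≢ i → k ≢ j → transpose i j k ≡ k
  transpose-other {i} {j} {k} k≢i k≢j rewrite dec-false (k ≟ i) k≢i | dec-false (k ≟ j) k≢j = refl

  transpose-involutive : ∀ (i j k : Fin n) → transpose i j (transpose i j k) ≡ k
  transpose-involutive i j k = by-cases (k ≟ i) (k ≟ j)
    where
    by-cases : Dec (k ≡ i) → Dec (k ≡ j) → transpose i j (transpose i j k) ≡ k
    by-cases (yes refl) _ = trans (cong (transpose k j) (transpose-matchˡ k j)) (transpose-matchʳ k j)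
    by-cases (no _) (yes refl) = trans (cong (transpose i k) (transpose-matchʳ i k)) (transpose-matchˡ i k)
    by-cases (no k≢i) (no k≢j) = trans (cong (transpose i j) (transpose-other k≢i k≢j)) (transpose-other k≢i k≢j)

  transpose-injective : ∀ (i j : Fin n) {x y} → transpose i j x ≡ transpose i j y → x ≡ y
  transpose-injective i j {x} {y} eq = begin
    x                               ≡⟨ transpose-involutive i j x ⟨
    transpose i j (transpose i j x) ≡⟨ cong (transpose i j) eq ⟩
    transpose i j (transpose i j y) ≡⟨ transpose-involutive i j y ⟩
    y                               ∎
    where open ≡-Reasoning

  transpose-isPerm : ∀ (i j : Fin n) → IsPerm (tabulate (transpose i j))
  transpose-isPerm i j {x} {y} eq = transpose-injective i j
    (trans (sym (lookup∘tabulate (transpose i j) x)) (trans eq (lookup∘tabulate (transpose i j) y)))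

module _ {n : ℕ} where

  act-signChange-involutive : ∀ (ε : Fin n → Bool) z → act (signChange ε) (act (signChange ε) z) ≡ z
  act-signChange-involutive ε (s , x) =
    trans (cong (act (signChange ε)) (act-signChange ε s x))
          (trans (act-signChange ε (s xor ε x) x) (cong (_, x) (xor-cancelʳ s (ε x))))

  InPair : Fin n → Fin n → Fin n → Set
  InPair j k x = x ≡ j ⊎ x ≡ k

  inPair? : ∀ j k x → Dec (InPair j k x)
  inPair? j k x = x ≟ j ⊎-dec x ≟ k

  negatePair : Fin n → Fin n → Raw n
  negatePair j k = signChange λ x → does (inPair? j k x)

  act-negatePair-∈ : ∀ {j k} z → InPair j k (index z) → act (negatePair j k) z ≡ neg z
  act-negatePair-∈ {j} {k} (s , x) x∈ = trans (act-signChange _ s x)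
    (cong (_, x) (trans (cong (s xor_) (dec-true (inPair? j k x) x∈)) (xor-comm s true)))

  act-negatePair-∉ : ∀ {j k} z → ¬ InPair j k (index z) → act (negatePair j k) z ≡ z
  act-negatePair-∉ {j} {k} (s , x) x∉ = trans (act-signChange _ s x)
    (cong (_, x) (trans (cong (s xor_) (dec-false (inPair? j k x) x∉)) (xor-identityʳ s)))

  transposition : Fin n → Fin n → Raw n
  transposition j k = tabulate λ x → (false , transpose j k x)

  act-transposition : ∀ j k s x → act (transposition j k) (s , x) ≡ (s , transpose j k x)
  act-transposition j k s x =
    trans (act-tabulate (λ y → (false , transpose j k y)) s x) (cong (_, _) (xor-identityʳ s))

  act-transposition-involutive : ∀ j k z → act (transposition j k) (act (transposition j k) z) ≡ z
  act-transposition-involutive j k (s , x) = begin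
    act (transposition j k) (act (transposition j k) (s , x)) ≡⟨ cong (act (transposition j k)) (act-transposition j k s x) ⟩
    act (transposition j k) (s , transpose j k x)             ≡⟨ act-transposition j k s _ ⟩
    (s , transpose j k (transpose j k x))                     ≡⟨ cong (s ,_) (transpose-involutive j k x) ⟩
    (s , x)                                                   ∎
    where open ≡-Reasoning

  act-transposition-∉ : ∀ {j k} z → ¬ InPair j k (index z) → act (transposition j k) z ≡ z
  act-transposition-∉ {j} {k} (s , x) x∉ =
    trans (act-transposition j k s x) (cong (s ,_) (transpose-other (x∉ ∘ inj₁) (x∉ ∘ inj₂)))

  transposition-diagonal : ∀ j → transposition j j ≡ idˢ
  transposition-diagonal j = act-injective λ z → trans (by-cases z (index z ≟ j)) (sym (act-idˢ z))
    where
    by-cases : ∀ z → Dec (index z ≡ j) → act (transposition j j) z ≡ z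
    by-cases (s , x) (yes refl) = trans (act-transposition x x s x) (cong (s ,_) (transpose-matchˡ x x))
    by-cases z (no z≢j) = act-transposition-∉ z [ z≢j , z≢j ]

-- Conjugation

module Conjugation {n : ℕ} (u v : Raw n)
  (u∘v : ∀ z → act u (act v z) ≡ z) (v∘u : ∀ z → act v (act u z) ≡ z) where

  conj : Raw n → Raw n
  conj w = (u ∘ˢ w) ∘ˢ v

  act-conj : ∀ w z → act (conj w) z ≡ act u (act w (act v z))
  act-conj w z = trans (act-∘ˢ (u ∘ˢ w) v z) (act-∘ˢ u w (act v z))

  underlying-u-v : ∀ x → underlying u (underlying v x) ≡ x
  underlying-u-v x = cong index (u∘v (false , x))

  underlying-v-u : ∀ x → underlying v (underlying u x) ≡ x
  underlying-v-u x = cong index (v∘u (false , x))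

  InPair-v⇒u : ∀ {j k} x → InPair j k (underlying v x) → InPair (underlying u j) (underlying u k) x
  InPair-v⇒u x = map v⇒u v⇒u
    where
    v⇒u : ∀ {y} → underlying v x ≡ y → x ≡ underlying u y
    v⇒u eq = trans (sym (underlying-u-v x)) (cong (underlying u) eq)

  InPair-u⇒v : ∀ {j k} x → InPair (underlying u j) (underlying u k) x → InPair j k (underlying v x)
  InPair-u⇒v x = map u⇒v u⇒v
    where
    u⇒v : ∀ {y} → x ≡ underlying u y → underlying v x ≡ y
    u⇒v eq = trans (cong (underlying v) eq) (underlying-v-u _)

  conj-negatePair : ∀ j k → conj (negatePair j k) ≡ negatePair (underlying u j) (underlying u k)
  conj-negatePair j k = act-injective λ z → trans (act-conj (negatePair j k) z) (by-cases z (inPair? j k _))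
    where
    by-cases : ∀ z → Dec (InPair j k (index (act v z))) →
               act u (act (negatePair j k) (act v z)) ≡ act (negatePair (underlying u j) (underlying u k)) z
    by-cases z (yes v-z∈) = begin
      act u (act (negatePair j k) (act v z)) ≡⟨ cong (act u) (act-negatePair-∈ (act v z) v-z∈) ⟩
      act u (neg (act v z))                  ≡⟨ act-neg u (act v z) ⟩
      neg (act u (act v z))                  ≡⟨ cong neg (u∘v z) ⟩
      neg z                                  ≡⟨ act-negatePair-∈ z (InPair-v⇒u (index z) v-z∈) ⟨
      act (negatePair _ _) z                 ∎
      where open ≡-Reasoning
    by-cases z (no v-z∉) = begin
      act u (act (negatePair j k) (act v z)) ≡⟨ cong (act u) (act-negatePair-∉ (act v z) v-z∉) ⟩
      act u (act v z)                        ≡⟨ u∘v z ⟩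
      z                                      ≡⟨ act-negatePair-∉ z (v-z∉ ∘ InPair-u⇒v (index z)) ⟨
      act (negatePair _ _) z                 ∎
      where open ≡-Reasoning

  conj-involutive : ∀ w → (∀ z → act w (act w z) ≡ z) → ∀ z → act (conj w) (act (conj w) z) ≡ z
  conj-involutive w w-inv z = begin
    act (conj w) (act (conj w) z)             ≡⟨ act-conj w (act (conj w) z) ⟩
    act u (act w (act v (act (conj w) z)))    ≡⟨ cong (λ y → act u (act w (act v y))) (act-conj w z) ⟩
    act u (act w (act v (act u (act w (act v z))))) ≡⟨ cong (λ y → act u (act w y)) (v∘u (act w (act v z))) ⟩
    act u (act w (act w (act v z)))           ≡⟨ cong (act u) (w-inv (act v z)) ⟩
    act u (act v z)                           ≡⟨ u∘v z ⟩
    z                                         ∎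
    where open ≡-Reasoning

  conj-fixes : ∀ w {j k} → (∀ z → ¬ InPair j k (index z) → act w z ≡ z) →
               ∀ z → ¬ InPair (underlying u j) (underlying u k) (index z) → act (conj w) z ≡ z
  conj-fixes w w-fixes z z∉ = begin
    act (conj w) z          ≡⟨ act-conj w z ⟩
    act u (act w (act v z)) ≡⟨ cong (act u) (w-fixes (act v z) (z∉ ∘ InPair-v⇒u (index z))) ⟩
    act u (act v z)         ≡⟨ u∘v z ⟩
    z                       ∎
    where open ≡-Reasoning

  underlying-conj-transposition : ∀ j k →
    underlying (conj (transposition j k)) (underlying u j) ≡ underlying u k
  underlying-conj-transposition j k = begin
    index (act (conj t) (false , p))      ≡⟨ cong index (act-conj t (false , p)) ⟩
    underlying u (index (act t (act v (false , p))))
      ≡⟨ cong (underlying u ∘ index) (act-transposition j k (proj₁ (lookup v p)) (underlying v p)) ⟩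
    underlying u (transpose j k (underlying v p)) ≡⟨ cong (underlying u ∘ transpose j k) (underlying-v-u j) ⟩
    underlying u (transpose j k j)        ≡⟨ cong (underlying u) (transpose-matchˡ j k) ⟩
    underlying u k                        ∎
    where
    open ≡-Reasoning
    t = transposition j k
    p = underlying u j

module _ {n : ℕ} (c : Raw n) (p q : Fin n) (c-involutive : ∀ z → act c (act c z) ≡ z)
  (c-p : underlying c p ≡ q) (c-fixes : ∀ z → ¬ InPair p q (index z) → act c z ≡ z) where

  private
    α = proj₁ (lookup c p)

    c²-p : (α xor proj₁ (lookup c q) , underlying c q) ≡ (false , p)
    c²-p = trans (cong (λ y → act c (α , y)) (sym c-p)) (c-involutive (false , p))

    act-c-InPair : ∀ {s x} → InPair p q x → act c (s xor α , x) ≡ (s , transpose p q x)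
    act-c-InPair {s} (inj₁ refl) = cong₂ _,_ (xor-cancelʳ s α) (trans c-p (sym (transpose-matchˡ p q)))
    act-c-InPair {s} (inj₂ refl) = cong₂ _,_
      (trans (cong ((s xor α) xor_) (xor≡false⇒≡ (cong proj₁ c²-p))) (xor-cancelʳ s α))
      (trans (cong proj₂ c²-p) (sym (transpose-matchʳ p q)))

  -- Being an involution, c carries the same sign α at p and at q; the sign change at p and q,
  -- applied when α = true, removes it.
  signedTransposition-normalise :
    c ∘ˢ signChange (λ x → α ∧ does (inPair? p q x)) ≡ transposition p q
  signedTransposition-normalise = act-injective λ { (s , x) →
    trans (act-∘ˢ c corrector (s , x))
          (trans (cong (act c) (act-signChange ε s x)) (by-cases s x (inPair? p q x))) }
    where
    ε = λ x → α ∧ does (inPair? p q x)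
    corrector = signChange ε
    by-cases : ∀ s x → Dec (InPair p q x) →
               act c (s xor (α ∧ does (inPair? p q x)) , x) ≡ act (transposition p q) (s , x)
    by-cases s x (yes x∈) rewrite dec-true (inPair? p q x) x∈ | ∧-identityʳ α =
      trans (act-c-InPair x∈) (sym (act-transposition p q s x))
    by-cases s x (no x∉) rewrite dec-false (inPair? p q x) x∉ | ∧-zeroʳ α | xor-identityʳ s =
      trans (c-fixes (s , x) x∉) (sym (act-transposition-∉ (s , x) x∉))

transpose-transitive-on-pairs : ∀ {n} (P : Fin n → Fin n → Set) →
  (∀ a b {x y} → x ≢ y → P x y → P (transpose a b x) (transpose a b y)) →
  ∀ {j k} → j ≢ k → P j k → ∀ {p q} → p ≢ q → P p q
transpose-transitive-on-pairs P P-closed {j} {k} j≢k Pjk {p} {q} p≢q =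
  subst₂ P (transpose-other p≢q p≢k′) (transpose-matchʳ q k′) (P-closed q k′ p≢k′ Ppk′)
  where
  k′ = transpose p j k
  Ppk′ : P p k′
  Ppk′ = subst (λ x → P x k′) (transpose-matchʳ p j) (P-closed p j j≢k Pjk)
  p≢k′ : p ≢ k′
  p≢k′ p≡k′ = j≢k (begin
    j                                ≡⟨ transpose-matchˡ p j ⟨
    transpose p j p                  ≡⟨ cong (transpose p j) p≡k′ ⟩
    transpose p j (transpose p j k)  ≡⟨ transpose-involutive p j k ⟩
    k                                ∎)
    where open ≡-Reasoning

-- Parity of the number of negative signs

⊕-commutativeMonoid : CommutativeMonoid 0ℓ 0ℓ
⊕-commutativeMonoid = CommutativeRing.+-commutativeMonoid xor-∧-commutativeRing

open Sum ⊕-commutativeMonoid using (sum; sum-cong-≗; sum-replicate-zero; ∑-distrib-+)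

isOdd : ℕ → Bool
isOdd zero = false
isOdd (suc m) = not (isOdd m)

2∣⇒isOdd≡false : ∀ {m} → 2 ∣ m → isOdd m ≡ false
2∣⇒isOdd≡false (divides q refl) = isOdd-*2 q
  where
  isOdd-*2 : ∀ q → isOdd (q * 2) ≡ false
  isOdd-*2 zero = refl
  isOdd-*2 (suc q) = trans (not-involutive _) (isOdd-*2 q)

signParity : ∀ {n m} → Vec (Letter n) m → Bool
signParity v = sum λ k → proj₁ (lookup v k)

isOdd-negCount : ∀ {n m} (v : Vec (Letter n) m) → isOdd (negCount v) ≡ signParity v
isOdd-negCount [] = refl
isOdd-negCount ((false , _) ∷ v) = isOdd-negCount v
isOdd-negCount ((true , _) ∷ v) = cong not (isOdd-negCount v)

sum-indicator : ∀ {n} (p : Fin n) → sum (λ x → does (x ≟ p)) ≡ true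
sum-indicator {suc n} zero = cong not (sum-replicate-zero n)
sum-indicator (suc p) = sum-indicator p

sum-pairIndicator : ∀ {n} {j k : Fin n} → j ≢ k → sum (λ x → does (inPair? j k x)) ≡ false
sum-pairIndicator {j = j} {k} j≢k = begin
  sum (λ x → does (inPair? j k x))                   ≡⟨ sum-cong-≗ pair-indicator ⟩
  sum (λ x → does (x ≟ j) xor does (x ≟ k))          ≡⟨ ∑-distrib-+ (λ x → does (x ≟ j)) (λ x → does (x ≟ k)) ⟩
  sum (λ x → does (x ≟ j)) xor sum (λ x → does (x ≟ k)) ≡⟨ cong₂ _xor_ (sum-indicator j) (sum-indicator k) ⟩
  false                                              ∎
  where
  open ≡-Reasoning
  pair-indicator : ∀ x → does (inPair? j k x) ≡ does (x ≟ j) xor does (x ≟ k)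
  pair-indicator x with x ≟ j | x ≟ k
  ... | yes refl | yes refl = ⊥-elim (j≢k refl)
  ... | yes _ | no _ = refl
  ... | no _ | _ = refl

signParity-∘ˢ-signChange : ∀ {n} (w : Raw n) ε → signParity (w ∘ˢ signChange ε) ≡ sum ε xor signParity w
signParity-∘ˢ-signChange w ε = trans (sum-cong-≗ sign-at) (∑-distrib-+ ε λ k → proj₁ (lookup w k))
  where
  sign-at : ∀ k → proj₁ (lookup (w ∘ˢ signChange ε) k) ≡ ε k xor proj₁ (lookup w k)
  sign-at k = cong proj₁ (trans (lookup∘tabulate _ k) (cong (act w) (lookup∘tabulate _ k)))

signParity-lone : ∀ {n} (w : Raw (suc n)) → (∀ k → proj₁ (lookup w (suc k)) ≡ false) →
                  signParity w ≡ proj₁ (lookup w zero)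
signParity-lone {n} w rest =
  trans (cong (proj₁ (lookup w zero) xor_) (trans (sum-cong-≗ rest) (sum-replicate-zero n))) (xor-identityʳ _)

-- Generation of W_n^+

module Generation {n : ℕ} (H : Raw n → Set) (H-subgroup : IsSubgroup H)
  (negatePair∈H : ∀ {p q} → p ≢ q → H (negatePair p q))
  (transposition∈H : ∀ p q → H (transposition p q)) where
  open IsSubgroup H-subgroup

  FixedFrom : ℕ → Raw n → Set
  FixedFrom m w = ∀ k → m ≤ toℕ k → lookup w k ≡ (false , k)

  Generated : ℕ → Set
  Generated m = ∀ w → IsSignedPerm w → signParity w ≡ false → FixedFrom m w → H w

  generated-zero : Generated 0
  generated-zero w _ _ w-fixed = subst H (sym w≡idˢ) has-id
    where
    w≡idˢ : w ≡ idˢ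
    w≡idˢ = trans (sym (tabulate∘lookup w)) (tabulate-cong λ k → w-fixed k z≤n)

  generated-positive : ∀ M → Generated (toℕ M) →
    ∀ w → IsSignedPerm w → signParity w ≡ false → FixedFrom (suc (toℕ M)) w →
    proj₁ (lookup w M) ≡ false → H w
  generated-positive M ih w w-perm w-even w-fixed w-M =
    subst H t∘w′≡w (closed _ _ (transposition∈H p M) (ih w′ w′-perm w′-even w′-fixed))
    where
    p = underlying w M
    t = transposition p M
    w′ = t ∘ˢ w

    lookup-w′ : ∀ k → lookup w′ k ≡ (proj₁ (lookup w k) , transpose p M (underlying w k))
    lookup-w′ k = trans (lookup∘tabulate _ k) (act-transposition p M _ _)

    w′-perm : IsSignedPerm w′
    w′-perm {x} {y} eq = w-perm (transpose-injective p M
      (trans (sym (cong proj₂ (lookup-w′ x))) (trans eq (cong proj₂ (lookup-w′ y)))))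

    w′-even : signParity w′ ≡ false
    w′-even = trans (sum-cong-≗ λ k → cong proj₁ (lookup-w′ k)) w-even

    w′-fixed : FixedFrom (toℕ M) w′
    w′-fixed k M≤k with m≤n⇒m<n∨m≡n M≤k
    ... | inj₁ M<k = trans (lookup-w′ k)
          (cong₂ _,_ (cong proj₁ w-k) (trans (cong (transpose p M) (cong proj₂ w-k)) (transpose-other k≢p k≢M)))
      where
      w-k = w-fixed k M<k
      k≢M : k ≢ M
      k≢M = ≢-sym (<⇒≢ M<k)
      k≢p : k ≢ p
      k≢p k≡p = k≢M (w-perm (trans (cong proj₂ w-k) k≡p))
    ... | inj₂ M≡k with toℕ-injective M≡k
    ...   | refl = trans (lookup-w′ M) (cong₂ _,_ w-M (transpose-matchˡ p M))

    t∘w′≡w : t ∘ˢ w′ ≡ w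
    t∘w′≡w = act-injective λ z →
      trans (act-∘ˢ t w′ z) (trans (cong (act t) (act-∘ˢ t w z)) (act-transposition-involutive p M (act w z)))

  generated-step : ∀ M → Generated (toℕ M) → Generated (suc (toℕ M))
  generated-step M ih w w-perm w-even w-fixed with proj₁ (lookup w M) in w-M
  ... | false = generated-positive M ih w w-perm w-even w-fixed w-M
  generated-step zero ih w w-perm w-even w-fixed | true
    -- a lone sign change at index 0 is odd
    with () ← trans (sym w-M) (trans (sym (signParity-lone w λ k → cong proj₁ (w-fixed (suc k) (s≤s z≤n)))) w-even)
  generated-step M@(suc _) ih w w-perm w-even w-fixed | true =
    subst H w′∘N≡w (closed _ _ (generated-positive M ih w′ w′-perm w′-even w′-fixed w′-M) (negatePair∈H M≢0))
    where
    M≢0 : M ≢ zero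
    M≢0 ()
    ε = λ x → does (inPair? M zero x)
    N = negatePair M zero
    w′ = w ∘ˢ N

    lookup-w′ : ∀ k → lookup w′ k ≡ act w (does (inPair? M zero k) , k)
    lookup-w′ k = trans (lookup∘tabulate (λ x → act w (lookup N x)) k)
                        (cong (act w) (lookup∘tabulate (λ x → (ε x , x)) k))

    w′-perm : IsSignedPerm w′
    w′-perm {x} {y} eq = w-perm (trans (sym (cong proj₂ (lookup-w′ x))) (trans eq (cong proj₂ (lookup-w′ y))))

    w′-even : signParity w′ ≡ false
    w′-even = trans (signParity-∘ˢ-signChange w ε) (cong₂ _xor_ (sum-pairIndicator M≢0) w-even)

    w′-fixed : FixedFrom (suc (toℕ M)) w′
    w′-fixed k M<k = begin
      lookup w′ k                           ≡⟨ lookup-w′ k ⟩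
      act w (does (inPair? M zero k) , k)   ≡⟨ cong (λ b → act w (b , k)) (dec-false (inPair? M zero k) k∉) ⟩
      lookup w k                            ≡⟨ w-fixed k M<k ⟩
      (false , k)                           ∎
      where
      open ≡-Reasoning
      k∉ : ¬ InPair M zero k
      k∉ = [ ≢-sym (<⇒≢ M<k) , ≢-sym (<⇒≢ (<-trans (s≤s z≤n) M<k)) ]

    w′-M : proj₁ (lookup w′ M) ≡ false
    w′-M = trans (cong proj₁ (lookup-w′ M))
                 (cong₂ _xor_ (dec-true (inPair? M zero M) (inj₁ refl)) w-M)

    w′∘N≡w : w′ ∘ˢ N ≡ w
    w′∘N≡w = act-injective λ z →
      trans (act-∘ˢ w′ N z) (trans (act-∘ˢ w N (act N z)) (cong (act w) (act-signChange-involutive ε z)))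

  generated : ∀ m → m ≤ n → Generated m
  generated zero _ = generated-zero
  generated (suc m) m<n = subst (λ m → Generated (suc m)) (toℕ-fromℕ< m<n)
    (generated-step (fromℕ< m<n) (subst Generated (sym (toℕ-fromℕ< m<n)) (generated m (<⇒≤ m<n))))

  W⁺⊆H : ∀ w → InWPlus w → H w
  W⁺⊆H w (w-perm , 2∣negCount) = generated n ≤-refl w w-perm
    (trans (sym (isOdd-negCount w)) (2∣⇒isOdd≡false 2∣negCount))
    (λ k n≤k → ⊥-elim (<⇒≱ (toℕ<n k) n≤k))

-- Signed 2+4-cycles

-- g = (a −a)(c d −c −d)
record SignedTwoFourCycle {n : ℕ} (g : Raw n) : Set where
  field
    a c d   : Letter n
    a≁c     : index a ≢ index c
    a≁d     : index a ≢ index d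
    c≁d     : index c ≢ index d
    g-a     : act g a ≡ neg a
    g-c     : act g c ≡ d
    g-d     : act g d ≡ neg c
    g-other : ∀ z → index z ≢ index a → index z ≢ index c → index z ≢ index d → act g z ≡ z

module TwoFourCycleShape {n : ℕ} (g : Raw n) (a b c d e f : Letter n)
  (a≢b : a ≢ b) (a≢c : a ≢ c) (a≢d : a ≢ d) (a≢e : a ≢ e) (a≢f : a ≢ f)
  (b≢c : b ≢ c) (b≢d : b ≢ d) (b≢e : b ≢ e) (b≢f : b ≢ f)
  (c≢d : c ≢ d) (c≢e : c ≢ e) (c≢f : c ≢ f) (d≢e : d ≢ e) (d≢f : d ≢ f) (e≢f : e ≢ f)
  (g-a : act g a ≡ b) (g-b : act g b ≡ a)
  (g-c : act g c ≡ d) (g-d : act g d ≡ e) (g-e : act g e ≡ f) (g-f : act g f ≡ c)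
  (g-fix : ∀ x → x ≢ a → x ≢ b → x ≢ c → x ≢ d → x ≢ e → x ≢ f → act g x ≡ x) where

  open ≡-Reasoning

  private
    data Position (x : Letter n) : Set where
      at-a : x ≡ a → Position x
      at-b : x ≡ b → Position x
      at-c : x ≡ c → Position x
      at-d : x ≡ d → Position x
      at-e : x ≡ e → Position x
      at-f : x ≡ f → Position x
      fixed : act g x ≡ x → Position x

    _≟ᴸ_ : DecidableEquality (Letter n)
    _≟ᴸ_ = ≡-dec Bool._≟_ _≟_

    position : ∀ x → Position x
    position x with x ≟ᴸ a
    ... | yes eq = at-a eq
    ... | no x≢a with x ≟ᴸ b
    ... | yes eq = at-b eq
    ... | no x≢b with x ≟ᴸ c
    ... | yes eq = at-c eq
    ... | no x≢c with x ≟ᴸ d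
    ... | yes eq = at-d eq
    ... | no x≢d with x ≟ᴸ e
    ... | yes eq = at-e eq
    ... | no x≢e with x ≟ᴸ f
    ... | yes eq = at-f eq
    ... | no x≢f = fixed (g-fix x x≢a x≢b x≢c x≢d x≢e x≢f)

    g²-neg-a : act g (act g (neg a)) ≡ neg a
    g²-neg-a = begin
      act g (act g (neg a)) ≡⟨ cong (act g) (trans (act-neg g a) (cong neg g-a)) ⟩
      act g (neg b)         ≡⟨ trans (act-neg g b) (cong neg g-b) ⟩
      neg a                 ∎

    -- −a lies on an orbit of length 2, so it is none of c, d, e, f.
    g²-fixes-at : ∀ {x y} → neg a ≡ x → act g (act g x) ≡ y → x ≡ y
    g²-fixes-at refl g²x≡y = trans (sym g²-neg-a) g²x≡y

  neg-a : neg a ≡ b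
  neg-a with position (neg a)
  ... | at-a eq = ⊥-elim (neg≢ a eq)
  ... | at-b eq = eq
  ... | at-c eq = ⊥-elim (c≢e (g²-fixes-at eq (trans (cong (act g) g-c) g-d)))
  ... | at-d eq = ⊥-elim (d≢f (g²-fixes-at eq (trans (cong (act g) g-d) g-e)))
  ... | at-e eq = ⊥-elim (c≢e (sym (g²-fixes-at eq (trans (cong (act g) g-e) g-f))))
  ... | at-f eq = ⊥-elim (d≢f (sym (g²-fixes-at eq (trans (cong (act g) g-f) g-c))))
  ... | fixed eq = ⊥-elim (a≢b (sym (neg-injective (trans (sym (trans (act-neg g a) (cong neg g-a))) eq))))

  private
    neg-b : neg b ≡ a
    neg-b = trans (cong neg (sym neg-a)) (neg-involutive a)

    g-neg-c : act g (neg c) ≡ neg d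
    g-neg-c = trans (act-neg g c) (cong neg g-c)

  neg-c : neg c ≡ e
  neg-c with position (neg c)
  ... | at-a eq = ⊥-elim (b≢c (sym (trans (sym (neg-involutive c)) (trans (cong neg eq) neg-a))))
  ... | at-b eq = ⊥-elim (a≢c (sym (trans (sym (neg-involutive c)) (trans (cong neg eq) neg-b))))
  ... | at-c eq = ⊥-elim (neg≢ c eq)
  ... | at-d eq = ⊥-elim (c≢e (begin
          c                 ≡⟨ neg-involutive c ⟨
          neg (neg c)       ≡⟨ cong neg eq ⟩
          neg d             ≡⟨ g-neg-c ⟨
          act g (neg c)     ≡⟨ cong (act g) eq ⟩
          act g d           ≡⟨ g-d ⟩
          e                 ∎))
  ... | at-e eq = eq
  ... | at-f eq = ⊥-elim (d≢f (begin
          d                   ≡⟨ neg-involutive d ⟨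
          neg (neg d)         ≡⟨ cong neg g-neg-c ⟨
          neg (act g (neg c)) ≡⟨ cong (λ x → neg (act g x)) eq ⟩
          neg (act g f)       ≡⟨ cong neg g-f ⟩
          neg c               ≡⟨ eq ⟩
          f                   ∎))
  ... | fixed eq = ⊥-elim (c≢d (neg-injective (trans (sym eq) g-neg-c)))

  neg-d : neg d ≡ f
  neg-d = trans (sym g-neg-c) (trans (cong (act g) neg-c) g-e)

  private
    index-b : index b ≡ index a
    index-b = cong index (sym neg-a)

    index-e : index e ≡ index c
    index-e = cong index (sym neg-c)

    index-f : index f ≡ index d
    index-f = cong index (sym neg-d)

    apart : ∀ {x y : Letter n} → x ≢ y → x ≢ neg y → index x ≢ index y
    apart {x} {y} x≢y x≢-y x~y = [ x≢y , x≢-y ] (same-index {z = x} {y} x~y)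

  signedTwoFourCycle : SignedTwoFourCycle g
  signedTwoFourCycle = record
    { a = a ; c = c ; d = d
    ; a≁c = apart (≢-sym a≢c) (λ c≡-a → b≢c (sym (trans c≡-a neg-a))) ∘ sym
    ; a≁d = apart (≢-sym a≢d) (λ d≡-a → b≢d (sym (trans d≡-a neg-a))) ∘ sym
    ; c≁d = apart (≢-sym c≢d) (λ d≡-c → d≢e (trans d≡-c neg-c)) ∘ sym
    ; g-a = trans g-a (sym neg-a)
    ; g-c = g-c
    ; g-d = trans g-d (sym neg-c)
    ; g-other = λ z z≁a z≁c z≁d → g-fix z
        (z≁a ∘ cong index) (λ z≡b → z≁a (trans (cong index z≡b) index-b))
        (z≁c ∘ cong index) (z≁d ∘ cong index)
        (λ z≡e → z≁c (trans (cong index z≡e) index-e)) (λ z≡f → z≁d (trans (cong index z≡f) index-f))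
    }

module SignedTwoFourCycleProperties {n : ℕ} {g : Raw n} (C : SignedTwoFourCycle g) where
  open SignedTwoFourCycle C
  open ≡-Reasoning

  i j k : Fin n
  i = index a
  j = index c
  k = index d

  private
    ≡-by-support : ∀ {u v : Raw n} → act u a ≡ act v a → act u c ≡ act v c → act u d ≡ act v d →
      (∀ z → index z ≢ i → index z ≢ j → index z ≢ k → act u z ≡ act v z) → u ≡ v
    ≡-by-support {u} {v} on-a on-c on-d outside = act-injective λ z →
      by-cases z (index z ≟ i) (index z ≟ j) (index z ≟ k)
      where
      by-cases : ∀ z → Dec (index z ≡ i) → Dec (index z ≡ j) → Dec (index z ≡ k) → act u z ≡ act v z
      by-cases z (yes z~a) _ _ = agree-on-index u v a on-a z z~a
      by-cases z (no _) (yes z~c) _ = agree-on-index u v c on-c z z~c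
      by-cases z (no _) (no _) (yes z~d) = agree-on-index u v d on-d z z~d
      by-cases z (no z≁a) (no z≁c) (no z≁d) = outside z z≁a z≁c z≁d

    g-neg : ∀ x {y} → act g x ≡ y → act g (neg x) ≡ neg y
    g-neg x gx≡y = trans (act-neg g x) (cong neg gx≡y)

  g²≡negatePair : g ∘ˢ g ≡ negatePair j k
  g²≡negatePair = ≡-by-support
    (begin
      act (g ∘ˢ g) a  ≡⟨ act-∘ˢ g g a ⟩
      act g (act g a) ≡⟨ cong (act g) g-a ⟩
      act g (neg a)   ≡⟨ g-neg a g-a ⟩
      neg (neg a)     ≡⟨ neg-involutive a ⟩
      a               ≡⟨ act-negatePair-∉ a [ a≁c , a≁d ] ⟨
      act (negatePair j k) a ∎)
    (begin
      act (g ∘ˢ g) c  ≡⟨ act-∘ˢ g g c ⟩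
      act g (act g c) ≡⟨ cong (act g) g-c ⟩
      act g d         ≡⟨ g-d ⟩
      neg c           ≡⟨ act-negatePair-∈ c (inj₁ refl) ⟨
      act (negatePair j k) c ∎)
    (begin
      act (g ∘ˢ g) d  ≡⟨ act-∘ˢ g g d ⟩
      act g (act g d) ≡⟨ cong (act g) g-d ⟩
      act g (neg c)   ≡⟨ g-neg c g-c ⟩
      neg d           ≡⟨ act-negatePair-∈ d (inj₂ refl) ⟨
      act (negatePair j k) d ∎)
    (λ z z≁a z≁c z≁d → begin
      act (g ∘ˢ g) z  ≡⟨ act-∘ˢ g g z ⟩
      act g (act g z) ≡⟨ cong (act g) (g-other z z≁a z≁c z≁d) ⟩
      act g z         ≡⟨ g-other z z≁a z≁c z≁d ⟩
      z               ≡⟨ act-negatePair-∉ z [ z≁c , z≁d ] ⟨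
      act (negatePair j k) z ∎)

  -- the involution (c −d)(d −c)
  h : Raw n
  h = g ∘ˢ negatePair i j

  private
    h-a : act h a ≡ a
    h-a = begin
      act h a                   ≡⟨ act-∘ˢ g (negatePair i j) a ⟩
      act g (act (negatePair i j) a) ≡⟨ cong (act g) (act-negatePair-∈ a (inj₁ refl)) ⟩
      act g (neg a)             ≡⟨ g-neg a g-a ⟩
      neg (neg a)               ≡⟨ neg-involutive a ⟩
      a                         ∎

    h-c : act h c ≡ neg d
    h-c = begin
      act h c                   ≡⟨ act-∘ˢ g (negatePair i j) c ⟩
      act g (act (negatePair i j) c) ≡⟨ cong (act g) (act-negatePair-∈ c (inj₂ refl)) ⟩
      act g (neg c)             ≡⟨ g-neg c g-c ⟩
      neg d                     ∎

    h-d : act h d ≡ neg c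
    h-d = begin
      act h d                   ≡⟨ act-∘ˢ g (negatePair i j) d ⟩
      act g (act (negatePair i j) d) ≡⟨ cong (act g) (act-negatePair-∉ d [ a≁d ∘ sym , c≁d ∘ sym ]) ⟩
      act g d                   ≡⟨ g-d ⟩
      neg c                     ∎

    h-other : ∀ z → index z ≢ i → index z ≢ j → index z ≢ k → act h z ≡ z
    h-other z z≁a z≁c z≁d = begin
      act h z                   ≡⟨ act-∘ˢ g (negatePair i j) z ⟩
      act g (act (negatePair i j) z) ≡⟨ cong (act g) (act-negatePair-∉ z [ z≁a , z≁c ]) ⟩
      act g z                   ≡⟨ g-other z z≁a z≁c z≁d ⟩
      z                         ∎

    h-a′ : act h a ≡ act idˢ a
    h-a′ = trans h-a (sym (act-idˢ a))

  h-involutive : ∀ z → act h (act h z) ≡ z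
  h-involutive z = begin
    act h (act h z)   ≡⟨ act-∘ˢ h h z ⟨
    act (h ∘ˢ h) z    ≡⟨ cong (λ w → act w z) h²≡idˢ ⟩
    act idˢ z         ≡⟨ act-idˢ z ⟩
    z                 ∎
    where
    h²≡idˢ : h ∘ˢ h ≡ idˢ
    h²≡idˢ = ≡-by-support
      (trans (act-∘ˢ h h a) (trans (cong (act h) h-a) h-a′))
      (begin
        act (h ∘ˢ h) c  ≡⟨ act-∘ˢ h h c ⟩
        act h (act h c) ≡⟨ cong (act h) h-c ⟩
        act h (neg d)   ≡⟨ trans (act-neg h d) (cong neg h-d) ⟩
        neg (neg c)     ≡⟨ neg-involutive c ⟩
        c               ≡⟨ act-idˢ c ⟨
        act idˢ c       ∎)
      (begin
        act (h ∘ˢ h) d  ≡⟨ act-∘ˢ h h d ⟩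
        act h (act h d) ≡⟨ cong (act h) h-d ⟩
        act h (neg c)   ≡⟨ trans (act-neg h c) (cong neg h-c) ⟩
        neg (neg d)     ≡⟨ neg-involutive d ⟩
        d               ≡⟨ act-idˢ d ⟨
        act idˢ d       ∎)
      (λ z z≁a z≁c z≁d → trans (act-∘ˢ h h z)
        (trans (cong (act h) (h-other z z≁a z≁c z≁d)) (trans (h-other z z≁a z≁c z≁d) (sym (act-idˢ z)))))

  h-moves : underlying h j ≡ k
  h-moves = cong index h-c

  h-fixes : ∀ z → ¬ InPair j k (index z) → act h z ≡ z
  h-fixes z z∉ with index z ≟ i
  ... | yes z~a = trans (agree-on-index h idˢ a h-a′ z z~a) (act-idˢ z)
  ... | no z≁a = h-other z z≁a (z∉ ∘ inj₁) (z∉ ∘ inj₂)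

signedTwoFourCycle : ∀ {n} (g : Raw n) → IsTwoFourCycle g → SignedTwoFourCycle g
signedTwoFourCycle g (a , b , c , d , e , f , a≢b , a≢c , a≢d , a≢e , a≢f , b≢c , b≢d , b≢e , b≢f ,
                            c≢d , c≢e , c≢f , d≢e , d≢f , e≢f , g-a , g-b , g-c , g-d , g-e , g-f , g-fix) =
  TwoFourCycleShape.signedTwoFourCycle g a b c d e f a≢b a≢c a≢d a≢e a≢f b≢c b≢d b≢e b≢f
    c≢d c≢e c≢f d≢e d≢f e≢f g-a g-b g-c g-d g-e g-f g-fix

-- Subgroups surjecting onto S_n

module Subgroup {n : ℕ} (H : Raw n → Set) (H-subgroup : IsSubgroup H)
  (lift : ∀ (σ : Vec (Fin n) n) → IsPerm σ → ∃[ h ] (H h × proj h ≡ σ)) where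
  open IsSubgroup H-subgroup

  record TransposeLift (a b : Fin n) : Set where
    field
      u v    : Raw n
      u∈H    : H u
      v∈H    : H v
      u∘v    : ∀ z → act u (act v z) ≡ z
      v∘u    : ∀ z → act v (act u z) ≡ z
      u-over : ∀ x → underlying u x ≡ transpose a b x

    open Conjugation u v u∘v v∘u public

    conj∈H : ∀ {w} → H w → H (conj w)
    conj∈H w∈H = closed _ _ (closed _ _ u∈H w∈H) v∈H

  transposeLift : ∀ a b → TransposeLift a b
  transposeLift a b with lift (tabulate (transpose a b)) (transpose-isPerm a b)
  ... | u , u∈H , proj-u≡σ with inverse u u∈H
  ...   | v , v∈H , v∘u≡idˢ , u∘v≡idˢ = record
    { u = u ; v = v ; u∈H = u∈H ; v∈H = v∈H
    ; u∘v = ∘ˢ≡idˢ⇒act-inverse {g = u} {v} u∘v≡idˢ ; v∘u = ∘ˢ≡idˢ⇒act-inverse {g = v} {u} v∘u≡idˢ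
    ; u-over = λ x → trans (sym (lookup-map x proj₂ u))
                 (trans (cong (λ σ → lookup σ x) proj-u≡σ) (lookup∘tabulate (transpose a b) x))
    }

  negatePair-closed : ∀ a b {j k} → j ≢ k → H (negatePair j k) →
                      H (negatePair (transpose a b j) (transpose a b k))
  negatePair-closed a b {j} {k} _ N∈H =
    subst H (trans (conj-negatePair j k) (cong₂ negatePair (u-over j) (u-over k))) (conj∈H N∈H)
    where open TransposeLift (transposeLift a b)

  transposition∈H-from-signed : ∀ {c p q} → H c → H (negatePair p q) →
    (∀ z → act c (act c z) ≡ z) → underlying c p ≡ q → (∀ z → ¬ InPair p q (index z) → act c z ≡ z) →
    H (transposition p q)
  transposition∈H-from-signed {c} {p} {q} c∈H N∈H c-involutive c-p c-fixes =
    subst H (signedTransposition-normalise c p q c-involutive c-p c-fixes)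
      (closed _ _ c∈H (corrector∈H (proj₁ (lookup c p))))
    where
    corrector∈H : ∀ α → H (signChange λ x → α ∧ does (inPair? p q x))
    corrector∈H false = has-id
    corrector∈H true = N∈H

  module _ (negatePair∈H : ∀ {p q} → p ≢ q → H (negatePair p q)) where

    transposition-closed : ∀ a b {j k} → j ≢ k → H (transposition j k) →
                           H (transposition (transpose a b j) (transpose a b k))
    transposition-closed a b {j} {k} j≢k T∈H =
      subst₂ (λ p q → H (transposition p q)) (u-over j) (u-over k)
        (transposition∈H-from-signed (conj∈H T∈H) (negatePair∈H uj≢uk)
          (conj-involutive (transposition j k) (act-transposition-involutive j k))
          (underlying-conj-transposition j k)
          (conj-fixes (transposition j k) act-transposition-∉))
      where
      open TransposeLift (transposeLift a b)
      uj≢uk : underlying u j ≢ underlying u k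
      uj≢uk eq = j≢k (trans (sym (underlying-v-u j)) (trans (cong (underlying v) eq) (underlying-v-u k)))

    transposition∈H-everywhere : ∀ {j k} → j ≢ k → H (transposition j k) → ∀ p q → H (transposition p q)
    transposition∈H-everywhere j≢k T∈H p q with p ≟ q
    ... | yes refl = subst H (sym (transposition-diagonal p)) has-id
    ... | no p≢q = transpose-transitive-on-pairs (λ x y → H (transposition x y)) transposition-closed j≢k T∈H p≢q

  negatePair∈H-everywhere : ∀ {j k} → j ≢ k → H (negatePair j k) → ∀ {p q} → p ≢ q → H (negatePair p q)
  negatePair∈H-everywhere = transpose-transitive-on-pairs (λ x y → H (negatePair x y)) negatePair-closed

mainTheorem14 : (n : ℕ) (H : Raw n → Set) → IsSubgroup H →
    (∀ (σ : Vec (Fin n) n) → IsPerm σ → ∃[ h ] (H h × proj h ≡ σ)) →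
    (∃[ g ] (H g × IsTwoFourCycle g)) →
    ∀ (w : Raw n) → InWPlus w → H w
mainTheorem14 n H H-subgroup lift (g , g∈H , g-cycle) =
  Generation.W⁺⊆H H H-subgroup negatePair∈H transposition∈H
  where
  open IsSubgroup H-subgroup
  open Subgroup H H-subgroup lift
  C = signedTwoFourCycle g g-cycle
  open SignedTwoFourCycle C
  open SignedTwoFourCycleProperties C

  negatePair∈H : ∀ {p q} → p ≢ q → H (negatePair p q)
  negatePair∈H = negatePair∈H-everywhere c≁d (subst H g²≡negatePair (closed g g g∈H g∈H))

  transposition∈H : ∀ p q → H (transposition p q)
  transposition∈H = transposition∈H-everywhere negatePair∈H c≁d
    (transposition∈H-from-signed (closed g _ g∈H (negatePair∈H a≁c)) (negatePair∈H c≁d)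
      h-involutive h-moves h-fixes)
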